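{- Let $\sigma$ and $\tau$ be sign sequences with $\tau\preceq\sigma$. Then: (i) if $z(\sigma)=z(\tau)$ and $\tau$ is good, then $\sigma$ is good; (ii) if $z(\sigma)\neq z(\tau)$ and $\tau$ is reversing, then $\sigma$ is good.
   Context: A sign sequence is a finite sequence of elements of $\mathbb Z_3$; we write $+$ for $1$ and $-$ for $2=-1$. For a sign sequence $\sigma$, $z(\sigma)\in\{0,1\}$ is the number of occurrences of $0$ in $\sigma$ reduced modulo 2 (for the empty sequence it is $0$). For sign sequences $\tau$ and $\sigma=s_0\dots s_k$, define $\tau\preceq\sigma$ if there are indices $0\le i_0<i_1<\dots<i_m\le k$ with $\tau=s_{i_0}s_{i_1}\dots s_{i_m}$, $z(s_0\dots s_{i_0-1})=0$, and $z(s_{i_j+1}\dots s_{i_{j+1}-1})=0$ for every $0\le j\le m-1$. A pattern is a cyclically ordered partition of $\{1,2,3,4\}$ into three parts, one of size 2 and two of size 1; patterns differing by a cyclic shift of parts are identical. Write $(xy|z|w)$ for the pattern $(\{x,y\},\{z\},\{w\})$. For a pattern $\pi=(xy|z|w)$: the patterns $+$-compatible with $\pi$ are $\pi$ itself and the two patterns obtained by moving one of $x,y$ into the part preceding $\{x,y\}$ in the cyclic order (i.e. into $\{w\}$); the patterns $0$-compatible with $\pi$ are $(zw|x|y)$ and $(zw|y|x)$. Let $D$ be the graph on the 12 patterns with an undirected edge $\pi\rho$ when $\rho$ is $0$-compatible with $\pi$ (a symmetric relation), and a directed edge (possibly a loop) from $\pi$ to $\rho$ when $\rho$ is $+$-compatible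 with $\pi$. For a sign sequence $\sigma=s_0\dots s_k$, a $\sigma$-stroll is a sequence $\pi_0\pi_1\dots\pi_{k+1}$ of patterns such that for each $0\le j\le k$: if $s_j=0$ then $\pi_j\pi_{j+1}$ is an undirected edge of $D$; if $s_j=1$ there is a directed edge (possibly a loop) from $\pi_j$ to $\pi_{j+1}$; if $s_j=-1$ there is a directed edge (possibly a loop) from $\pi_{j+1}$ to $\pi_j$. It goes from $\pi_0$ to $\pi_{k+1}$. The sequence $\sigma$ is good if there is a $\sigma$-stroll from $(12|3|4)$ to $(12|4|3)$, and reversing if there is a $\sigma$-stroll from $(12|3|4)$ to $(34|1|2)$. -}

module Defs where

open import Data.Nat using (ℕ; zero; suc; _%_)
open import Data.Fin using (Fin; zero; suc)
open import Data.List using (List; []; _∷_; _++_)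
open import Data.Product using (Σ; _×_; _,_)
open import Data.Sum using (_⊎_)
open import Relation.Binary.PropositionalEquality using (_≡_; _≢_)

-- Sign sequences: finite sequences over ℤ₃ = Fin 3
-- (zero = 0, suc zero = 1 = "+", suc (suc zero) = 2 = -1 = "-").

SignSeq : Set
SignSeq = List (Fin 3)

zeros : SignSeq → ℕ
zeros []            = 0
zeros (zero ∷ σ)    = suc (zeros σ)
zeros (suc _ ∷ σ)   = zeros σ

z : SignSeq → ℕ
z σ = zeros σ % 2

-- τ ≼ σ : τ = s_{i₀} … s_{i_m} with z(s₀…s_{i₀-1}) = 0 and every gap
-- s_{i_j+1} … s_{i_{j+1}-1} having z = 0 (the tail after i_m is free).
data _≼_ : SignSeq → SignSeq → Set where
  empty : ∀ σ → [] ≼ σ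
  pick  : ∀ {t τ} α β → z α ≡ 0 → τ ≼ β → (t ∷ τ) ≼ (α ++ (t ∷ β))

data Elt : Set where
  e1 e2 e3 e4 : Elt

-- A pattern (xy|z|w) = cyclically ordered partition ({x,y},{z},{w}).
-- Since exactly one part has size 2, every cyclic shift can be rotated to
-- put the pair first, so a pattern is given by (x,y,z,w) all distinct,
-- with {x,y} an unordered pair (see _≈ₚ_); fields px py pz pw = x y z w.
record Pattern : Set where
  constructor ⟨_,_∣_∣_⟩
  field
    px py pz pw : Elt

open Pattern public

Valid : Pattern → Set
Valid ⟨ a , b ∣ c ∣ d ⟩ =
  a ≢ b × a ≢ c × a ≢ d × b ≢ c × b ≢ d × c ≢ d

_≈ₚ_ : Pattern → Pattern → Set
⟨ a , b ∣ c ∣ d ⟩ ≈ₚ ⟨ a' , b' ∣ c' ∣ d' ⟩ =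
  ((a ≡ a' × b ≡ b') ⊎ (a ≡ b' × b ≡ a')) × c ≡ c' × d ≡ d'

-- ρ is +-compatible with π = (xy|z|w): ρ is π, or obtained by moving x or y
-- into {w}: giving ({y},{z},{w,x}) = (wx|y|z), resp. (wy|x|z).
PlusCompat : Pattern → Pattern → Set
PlusCompat π ρ =
  ρ ≈ₚ π ⊎ ρ ≈ₚ ⟨ pw π , px π ∣ py π ∣ pz π ⟩ ⊎ ρ ≈ₚ ⟨ pw π , py π ∣ px π ∣ pz π ⟩

ZeroCompat : Pattern → Pattern → Set
ZeroCompat π ρ =
  ρ ≈ₚ ⟨ pz π , pw π ∣ px π ∣ py π ⟩ ⊎ ρ ≈ₚ ⟨ pz π , pw π ∣ py π ∣ px π ⟩

Step : Fin 3 → Pattern → Pattern → Set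
Step zero             π ρ = ZeroCompat π ρ   -- undirected edge πρ
Step (suc zero)       π ρ = PlusCompat π ρ   -- directed edge π → ρ
Step (suc (suc zero)) π ρ = PlusCompat ρ π   -- directed edge ρ → π

data Stroll : SignSeq → Pattern → Pattern → Set where
  done : ∀ {π} → Valid π → Stroll [] π π
  step : ∀ {s σ π ρ π'} → Valid π → Step s π ρ → Stroll σ ρ π' →
         Stroll (s ∷ σ) π π'

P12|3|4 P12|4|3 P34|1|2 : Pattern
P12|3|4 = ⟨ e1 , e2 ∣ e3 ∣ e4 ⟩
P12|4|3 = ⟨ e1 , e2 ∣ e4 ∣ e3 ⟩
P34|1|2 = ⟨ e3 , e4 ∣ e1 ∣ e2 ⟩

Good : SignSeq → Set
Good σ = Σ Pattern λ π → Σ Pattern λ π' →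
  π ≈ₚ P12|3|4 × π' ≈ₚ P12|4|3 × Stroll σ π π'

Reversing : SignSeq → Set
Reversing σ = Σ Pattern λ π → Σ Pattern λ π' →
  π ≈ₚ P12|3|4 × π' ≈ₚ P34|1|2 × Stroll σ π π'

-- Inserting blocks with an even number of zeros into a stroll costs nothing:
-- every pattern carries a loop of D, which absorbs the signs ±, and each 0 can be
-- taken along the edge π ↦ (zw|x|y), an involution.  So a τ-stroll lifts to a
-- σ-stroll ending at the same pattern when z σ = z τ, and at its image under the
-- involution otherwise; for a reversing τ the endpoint (43|1|2) is sent to (12|4|3).
module Submission where

open import Defs
open import Data.Empty using (⊥-elim)
open import Data.Fin using (zero; suc)
open import Data.List using ([]; _∷_; _++_)
open import Data.Nat using (ℕ; zero; suc; _%_; parity)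
open import Data.Parity.Base using (Parity; 0ℙ; 1ℙ; _⁻¹; _+_)
open import Data.Parity.Properties using (+-homo-+; +-identityʳ; p+p≡0ℙ)
import Data.Nat as ℕ
open import Data.Product using (Σ; _×_; _,_)
open import Data.Sum using (_⊎_; inj₁; inj₂)
open import Relation.Binary.PropositionalEquality
  using (_≡_; _≢_; refl; sym; trans; cong; cong₂; subst; module ≡-Reasoning)

zeroParity : SignSeq → Parity
zeroParity σ = parity (zeros σ)

parityToℕ : Parity → ℕ
parityToℕ 0ℙ = 0
parityToℕ 1ℙ = 1

parityToℕ-injective : ∀ {p q} → parityToℕ p ≡ parityToℕ q → p ≡ q
parityToℕ-injective {0ℙ} {0ℙ} _ = refl
parityToℕ-injective {1ℙ} {1ℙ} _ = refl

n%2≡parityToℕ∘parity : ∀ n → n % 2 ≡ parityToℕ (parity n)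
n%2≡parityToℕ∘parity zero          = refl
n%2≡parityToℕ∘parity (suc zero)    = refl
n%2≡parityToℕ∘parity (suc (suc n)) = n%2≡parityToℕ∘parity n

z≡⇒zeroParity≡ : ∀ σ τ → z σ ≡ z τ → zeroParity σ ≡ zeroParity τ
z≡⇒zeroParity≡ σ τ eq = parityToℕ-injective (begin
  parityToℕ (zeroParity σ) ≡⟨ sym (n%2≡parityToℕ∘parity (zeros σ)) ⟩
  z σ                      ≡⟨ eq ⟩
  z τ                      ≡⟨ n%2≡parityToℕ∘parity (zeros τ) ⟩
  parityToℕ (zeroParity τ) ∎)
  where open ≡-Reasoning

z≢⇒zeroParity≢ : ∀ σ τ → z σ ≢ z τ → zeroParity σ ≢ zeroParity τ
z≢⇒zeroParity≢ σ τ neq eq = neq (begin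
  z σ                      ≡⟨ n%2≡parityToℕ∘parity (zeros σ) ⟩
  parityToℕ (zeroParity σ) ≡⟨ cong parityToℕ eq ⟩
  parityToℕ (zeroParity τ) ≡⟨ sym (n%2≡parityToℕ∘parity (zeros τ)) ⟩
  z τ                      ∎)
  where open ≡-Reasoning

z≡0⇒zeroParity≡0ℙ : ∀ σ → z σ ≡ 0 → zeroParity σ ≡ 0ℙ
z≡0⇒zeroParity≡0ℙ σ eq =
  parityToℕ-injective (trans (sym (n%2≡parityToℕ∘parity (zeros σ))) eq)

p≢q⇒p+q≡1ℙ : ∀ {p q} → p ≢ q → p + q ≡ 1ℙ
p≢q⇒p+q≡1ℙ {0ℙ} {0ℙ} neq = ⊥-elim (neq refl)
p≢q⇒p+q≡1ℙ {0ℙ} {1ℙ} _   = refl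
p≢q⇒p+q≡1ℙ {1ℙ} {0ℙ} _   = refl
p≢q⇒p+q≡1ℙ {1ℙ} {1ℙ} neq = ⊥-elim (neq refl)

p⁻¹+q⁻¹≡p+q : ∀ p q → p ⁻¹ + q ⁻¹ ≡ p + q
p⁻¹+q⁻¹≡p+q 0ℙ 0ℙ = refl
p⁻¹+q⁻¹≡p+q 0ℙ 1ℙ = refl
p⁻¹+q⁻¹≡p+q 1ℙ 0ℙ = refl
p⁻¹+q⁻¹≡p+q 1ℙ 1ℙ = refl

zeros-++ : ∀ α γ → zeros (α ++ γ) ≡ zeros α ℕ.+ zeros γ
zeros-++ []          γ = refl
zeros-++ (zero  ∷ α) γ = cong suc (zeros-++ α γ)
zeros-++ (suc _ ∷ α) γ = zeros-++ α γ

zeroParity-++ : ∀ α γ → zeroParity (α ++ γ) ≡ zeroParity α + zeroParity γ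
zeroParity-++ α γ = trans (cong parity (zeros-++ α γ)) (+-homo-+ (zeros α) (zeros γ))

zeroParity-zero∷ : ∀ σ → zeroParity (zero ∷ σ) ≡ zeroParity σ ⁻¹
zeroParity-zero∷ σ = +-homo-+ 1 (zeros σ)

zeroParity-∷-+ : ∀ t β τ →
  zeroParity (t ∷ β) + zeroParity (t ∷ τ) ≡ zeroParity β + zeroParity τ
zeroParity-∷-+ zero    β τ = trans
  (cong₂ _+_ (zeroParity-zero∷ β) (zeroParity-zero∷ τ))
  (p⁻¹+q⁻¹≡p+q (zeroParity β) (zeroParity τ))
zeroParity-∷-+ (suc _) β τ = refl

zeroParity-insert : ∀ α t β τ → z α ≡ 0 →
  zeroParity (α ++ t ∷ β) + zeroParity (t ∷ τ) ≡ zeroParity β + zeroParity τ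
zeroParity-insert α t β τ zα = begin
  zeroParity (α ++ t ∷ β) + zeroParity (t ∷ τ)
    ≡⟨ cong (_+ zeroParity (t ∷ τ)) (zeroParity-++ α (t ∷ β)) ⟩
  zeroParity α + zeroParity (t ∷ β) + zeroParity (t ∷ τ)
    ≡⟨ cong (λ p → p + zeroParity (t ∷ β) + zeroParity (t ∷ τ)) (z≡0⇒zeroParity≡0ℙ α zα) ⟩
  zeroParity (t ∷ β) + zeroParity (t ∷ τ)
    ≡⟨ zeroParity-∷-+ t β τ ⟩
  zeroParity β + zeroParity τ ∎
  where open ≡-Reasoning

zeroMove : Pattern → Pattern
zeroMove π = ⟨ pz π , pw π ∣ px π ∣ py π ⟩

swapPair : Pattern → Pattern
swapPair π = ⟨ py π , px π ∣ pz π ∣ pw π ⟩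

flipBy : Parity → Pattern → Pattern
flipBy 0ℙ π = π
flipBy 1ℙ π = zeroMove π

flipBy-zeroMove : ∀ p π → flipBy p (zeroMove π) ≡ flipBy (p ⁻¹) π
flipBy-zeroMove 0ℙ π = refl
flipBy-zeroMove 1ℙ π = refl

≢-sym : ∀ {a b : Elt} → a ≢ b → b ≢ a
≢-sym neq eq = neq (sym eq)

Valid-zeroMove : ∀ π → Valid π → Valid (zeroMove π)
Valid-zeroMove π (ab , ac , ad , bc , bd , cd) =
  cd , ≢-sym ac , ≢-sym bc , ≢-sym ad , ≢-sym bd , ab

Valid-swapPair : ∀ π → Valid π → Valid (swapPair π)
Valid-swapPair π (ab , ac , ad , bc , bd , cd) = ≢-sym ab , bc , bd , ac , ad , cd

≈ₚ-refl : ∀ π → π ≈ₚ π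
≈ₚ-refl π = inj₁ (refl , refl) , refl , refl

swapPair-≈ₚˡ : ∀ ρ π → ρ ≈ₚ π → swapPair ρ ≈ₚ π
swapPair-≈ₚˡ ρ π (inj₁ (p , q) , r , s) = inj₂ (q , p) , r , s
swapPair-≈ₚˡ ρ π (inj₂ (p , q) , r , s) = inj₁ (q , p) , r , s

swapPair-≈ₚʳ : ∀ ρ π → ρ ≈ₚ π → ρ ≈ₚ swapPair π
swapPair-≈ₚʳ ρ π (inj₁ (p , q) , r , s) = inj₂ (p , q) , r , s
swapPair-≈ₚʳ ρ π (inj₂ (p , q) , r , s) = inj₁ (p , q) , r , s

step-swapPair : ∀ s π ρ → Step s π ρ → Step s π (swapPair ρ)
step-swapPair zero             π ρ (inj₁ e)        = inj₁ (swapPair-≈ₚˡ ρ _ e)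
step-swapPair zero             π ρ (inj₂ e)        = inj₂ (swapPair-≈ₚˡ ρ _ e)
step-swapPair (suc zero)       π ρ (inj₁ e)        = inj₁ (swapPair-≈ₚˡ ρ _ e)
step-swapPair (suc zero)       π ρ (inj₂ (inj₁ e)) = inj₂ (inj₁ (swapPair-≈ₚˡ ρ _ e))
step-swapPair (suc zero)       π ρ (inj₂ (inj₂ e)) = inj₂ (inj₂ (swapPair-≈ₚˡ ρ _ e))
step-swapPair (suc (suc zero)) π ρ (inj₁ e)        = inj₁ (swapPair-≈ₚʳ π ρ e)
step-swapPair (suc (suc zero)) π ρ (inj₂ (inj₁ e)) = inj₂ (inj₂ e)
step-swapPair (suc (suc zero)) π ρ (inj₂ (inj₂ e)) = inj₂ (inj₁ e)

stroll-++ : ∀ {α β π ρ π'} → Stroll α π ρ → Stroll β ρ π' → Stroll (α ++ β) π π'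
stroll-++ (done _)       s = s
stroll-++ (step v st r)  s = step v st (stroll-++ r s)

stroll-swapPair : ∀ {s σ π ρ} → Stroll (s ∷ σ) π ρ → Stroll (s ∷ σ) π (swapPair ρ)
stroll-swapPair {s} {π = π} (step {ρ = ρ} v st (done v′)) =
  step v (step-swapPair s π ρ st) (done (Valid-swapPair ρ v′))
stroll-swapPair (step v st r@(step _ _ _)) = step v st (stroll-swapPair r)

stroll-zeroMoves : ∀ σ π → Valid π → Stroll σ π (flipBy (zeroParity σ) π)
stroll-zeroMoves []                    π v = done v
stroll-zeroMoves (zero ∷ σ)            π v =
  step v (inj₁ (≈ₚ-refl (zeroMove π)))
    (subst (Stroll σ (zeroMove π))
      (trans (flipBy-zeroMove (zeroParity σ) π) (cong (λ p → flipBy p π) (sym (zeroParity-zero∷ σ))))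
      (stroll-zeroMoves σ (zeroMove π) (Valid-zeroMove π v)))
stroll-zeroMoves (suc zero ∷ σ)        π v = step v (inj₁ (≈ₚ-refl π)) (stroll-zeroMoves σ π v)
stroll-zeroMoves (suc (suc zero) ∷ σ)  π v = step v (inj₁ (≈ₚ-refl π)) (stroll-zeroMoves σ π v)

stroll-zeroMoves-even : ∀ α π → Valid π → z α ≡ 0 → Stroll α π π
stroll-zeroMoves-even α π v zα =
  subst (Stroll α π) (cong (λ p → flipBy p π) (z≡0⇒zeroParity≡0ℙ α zα))
    (stroll-zeroMoves α π v)

≼-stroll : ∀ {σ τ π π'} → τ ≼ σ → Stroll τ π π' →
  Stroll σ π (flipBy (zeroParity σ + zeroParity τ) π')
≼-stroll {π = π} (empty σ) (done v) =
  subst (Stroll σ π) (cong (λ p → flipBy p π) (sym (+-identityʳ (zeroParity σ))))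
    (stroll-zeroMoves σ π v)
≼-stroll {π = π} {π'} (pick {t} {τ} α β zα τ≼β) (step v st r) =
  subst (Stroll (α ++ t ∷ β) π) (cong (λ p → flipBy p π') (sym (zeroParity-insert α t β τ zα)))
    (stroll-++ (stroll-zeroMoves-even α π v zα) (step v st (≼-stroll τ≼β r)))

≼-stroll-flipBy : ∀ {σ τ π π' p} → τ ≼ σ → zeroParity σ + zeroParity τ ≡ p →
  Stroll τ π π' → Stroll σ π (flipBy p π')
≼-stroll-flipBy {σ} {π = π} {π'} τ≼σ eq r =
  subst (Stroll σ π) (cong (λ p → flipBy p π') eq) (≼-stroll τ≼σ r)

-- (43|1|2) is the representative of (34|1|2) that zeroMove sends to (12|4|3).
reversing⇒stroll-to-43|1|2 : ∀ {τ} → Reversing τ →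
  Σ Pattern λ π → π ≈ₚ P12|3|4 × Stroll τ π ⟨ e4 , e3 ∣ e1 ∣ e2 ⟩
reversing⇒stroll-to-43|1|2 (π , .π , (_ , π₃ , _) , (_ , π₁ , _) , done _)
  with trans (sym π₃) π₁
... | ()
reversing⇒stroll-to-43|1|2 (π , _ , p , (inj₁ (refl , refl) , refl , refl) , r@(step _ _ _)) =
  π , p , stroll-swapPair r
reversing⇒stroll-to-43|1|2 (π , _ , p , (inj₂ (refl , refl) , refl , refl) , r@(step _ _ _)) =
  π , p , r

lemma2p7 : (σ τ : SignSeq) → τ ≼ σ →
    (z σ ≡ z τ → Good τ → Good σ) × (z σ ≢ z τ → Reversing τ → Good σ)
lemma2p7 σ τ τ≼σ = sameParity , differentParity
  where
  sameParity : z σ ≡ z τ → Good τ → Good σ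
  sameParity eq (π , π' , p , p' , r) = π , π' , p , p' , ≼-stroll-flipBy τ≼σ parity≡0ℙ r
    where
    parity≡0ℙ : zeroParity σ + zeroParity τ ≡ 0ℙ
    parity≡0ℙ = trans (cong (zeroParity σ +_) (sym (z≡⇒zeroParity≡ σ τ eq))) (p+p≡0ℙ (zeroParity σ))

  differentParity : z σ ≢ z τ → Reversing τ → Good σ
  differentParity neq rev with reversing⇒stroll-to-43|1|2 rev
  ... | π , p , r =
    π , P12|4|3 , p , ≈ₚ-refl P12|4|3 ,
    ≼-stroll-flipBy τ≼σ (p≢q⇒p+q≡1ℙ (z≢⇒zeroParity≢ σ τ neq)) r
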